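{- Let $A$ be a meet-complemented lattice in which both $\Box a$ and $\Diamond a$ exist for every $a\in A$, and let $\{a_i: i\in I\}$ be an arbitrary subset of $A$. Then (i) if both $\bigwedge_{i\in I}a_i$ and $\bigwedge_{i\in I}\Box a_i$ exist, then $\bigwedge_{i\in I}\Box a_i=\Box\bigwedge_{i\in I}a_i$; and (ii) if both $\bigvee_{i\in I}a_i$ and $\bigvee_{i\in I}\Diamond a_i$ exist, then $\bigvee_{i\in I}\Diamond a_i=\Diamond\bigvee_{i\in I}a_i$.
   Context: A meet-complemented lattice is a lattice $(A,\wedge,\vee)$, not necessarily distributive, such that for every $a\in A$ the element $\neg a=\max\{b\in A: a\wedge b\le c\text{ for all }c\in A\}$ exists; it is bounded, with least element $0$ and greatest element $1$. For $a\in A$, $\Box a=\max\{b\in A: a\vee\neg b=1\}$ and $\Diamond a=\min\{b\in A: \neg a\vee b=1\}$. -}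

module Defs where

open import Level using (Level; _⊔_; suc)
open import Data.Product using (_×_)
open import Relation.Binary.Lattice.Bundles using (Lattice)

module _ {c ℓ₁ ℓ₂ : Level} (L : Lattice c ℓ₁ ℓ₂) where
  open Lattice L

  IsTop : Carrier → Set (c ⊔ ℓ₂)
  IsTop x = ∀ y → y ≤ x

  IsMeetComplement : Carrier → Carrier → Set (c ⊔ ℓ₂)
  IsMeetComplement a n =
    (∀ z → (a ∧ n) ≤ z) × (∀ b → (∀ z → (a ∧ b) ≤ z) → b ≤ n)

  IsInfimum : {ι : Level} {I : Set ι} → (I → Carrier) → Carrier → Set (c ⊔ ℓ₂ ⊔ ι)
  IsInfimum {I = I} f m = (∀ i → m ≤ f i) × (∀ x → (∀ i → x ≤ f i) → x ≤ m)

  IsSupremum : {ι : Level} {I : Set ι} → (I → Carrier) → Carrier → Set (c ⊔ ℓ₂ ⊔ ι)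
  IsSupremum {I = I} f m = (∀ i → f i ≤ m) × (∀ x → (∀ i → f i ≤ x) → m ≤ x)

record MeetComplementedLattice (c ℓ₁ ℓ₂ : Level) : Set (suc (c ⊔ ℓ₁ ⊔ ℓ₂)) where
  field
    lattice : Lattice c ℓ₁ ℓ₂
  open Lattice lattice public
  field
    ¬_ : Carrier → Carrier
    ¬-isMeetComplement : ∀ a → IsMeetComplement lattice a (¬ a)

  IsBox : Carrier → Carrier → Set (c ⊔ ℓ₂)
  IsBox a m = IsTop lattice (a ∨ (¬ m)) × (∀ b → IsTop lattice (a ∨ (¬ b)) → b ≤ m)

  IsDiamond : Carrier → Carrier → Set (c ⊔ ℓ₂)
  IsDiamond a m = IsTop lattice ((¬ a) ∨ m) × (∀ b → IsTop lattice ((¬ a) ∨ b) → m ≤ b)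

module Submission where

-- In a meet-complemented lattice, whenever □ and ◇ exist they
-- form a Galois connection  ◇ ⊣ □ :   ◇ b ≤ a  ⇔  b ≤ □ a.
-- Indeed both sides are equivalent to the covering condition  ¬ b ∨ a = 1:
-- the defining extremal properties of □ and ◇ give one direction each, and
-- the other direction uses that ¬ is antitone, ∨ is monotone and the top
-- element is upward closed.  The theorem is then an instance of the general
-- order-theoretic fact that a right adjoint preserves every infimum that
-- exists and a left adjoint preserves every supremum that exists.

open import Defs
open import Level using (Level)
open import Data.Product using (_×_; _,_; proj₁; proj₂)
open import Relation.Binary.Lattice.Bundles using (Lattice)
import Relation.Binary.Lattice.Properties.JoinSemilattice as JoinProperties
import Relation.Binary.Lattice.Properties.MeetSemilattice as MeetProperties

module GaloisConnection
  {c ℓ₁ ℓ₂ : Level} (L : Lattice c ℓ₁ ℓ₂) (f g : Lattice.Carrier L → Lattice.Carrier L)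
  (lower : ∀ {x y} → Lattice._≤_ L x (g y) → Lattice._≤_ L (f x) y)
  (raise : ∀ {x y} → Lattice._≤_ L (f x) y → Lattice._≤_ L x (g y))
  where

  open Lattice L

  -- The right adjoint is monotone: g x ≤ g y follows from the counit f (g x) ≤ x.
  g-monotone : ∀ {x y} → x ≤ y → g x ≤ g y
  g-monotone x≤y = raise (trans (lower refl) x≤y)

  -- The left adjoint is monotone: f x ≤ f y follows from the unit y ≤ g (f y).
  f-monotone : ∀ {x y} → x ≤ y → f x ≤ f y
  f-monotone x≤y = lower (trans x≤y (raise refl))

  -- If m = ⋀ a and n = ⋀ (g ∘ a) both exist, then n ≈ g m.
  -- (≤): f n is below every a i, hence below m.  (≥): g m is below every g (a i).
  right-adjoint-preserves-infima :
    ∀ {ι} {I : Set ι} (a : I → Carrier) (m n : Carrier)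
    → IsInfimum L a m → IsInfimum L (λ i → g (a i)) n → n ≈ g m
  right-adjoint-preserves-infima a m n (m≤a , m-greatest) (n≤ga , n-greatest) =
    antisym (raise (m-greatest (f n) (λ i → lower (n≤ga i))))
            (n-greatest (g m) (λ i → g-monotone (m≤a i)))

  left-adjoint-preserves-suprema :
    ∀ {ι} {I : Set ι} (a : I → Carrier) (m n : Carrier)
    → IsSupremum L a m → IsSupremum L (λ i → f (a i)) n → n ≈ f m
  left-adjoint-preserves-suprema a m n (a≤m , m-least) (fa≤n , n-least) =
    antisym (n-least (f m) (λ i → f-monotone (a≤m i)))
            (lower (m-least (g n) (λ i → raise (fa≤n i))))

module ModalAdjunction
  {c ℓ₁ ℓ₂ : Level} (A : MeetComplementedLattice c ℓ₁ ℓ₂)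
  (□ ◇ : MeetComplementedLattice.Carrier A → MeetComplementedLattice.Carrier A)
  (□-spec : ∀ a → MeetComplementedLattice.IsBox A a (□ a))
  (◇-spec : ∀ a → MeetComplementedLattice.IsDiamond A a (◇ a))
  where

  open MeetComplementedLattice A
  open JoinProperties joinSemilattice using (∨-monotonic; ∨-comm)
  open MeetProperties meetSemilattice using (∧-monotonic)

  top-upward-closed : ∀ {x y} → IsTop lattice x → x ≤ y → IsTop lattice y
  top-upward-closed x-top x≤y z = trans (x-top z) x≤y

  -- The meet-complement is antitone: if x ≤ y then x ∧ ¬ y ≤ y ∧ ¬ y is
  -- below everything, so ¬ y lies below the largest such element ¬ x.
  ¬-antitone : ∀ {x y} → x ≤ y → ¬ y ≤ ¬ x
  ¬-antitone {x} {y} x≤y =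
    proj₂ (¬-isMeetComplement x) (¬ y)
      (λ z → trans (∧-monotonic x≤y refl) (proj₁ (¬-isMeetComplement y) z))

  -- Covering condition  ¬ b ∨ a = 1, the common content of ◇ b ≤ a and b ≤ □ a.
  Covers : Carrier → Carrier → Set _
  Covers b a = IsTop lattice (¬ b ∨ a)

  covers-swap : ∀ {x y} → IsTop lattice (x ∨ y) → IsTop lattice (y ∨ x)
  covers-swap {x} {y} t = top-upward-closed t (reflexive (∨-comm x y))

  -- b ≤ □ a gives ¬ □ a ≤ ¬ b, so the cover a ∨ ¬ □ a yields ¬ b ∨ a = 1.
  covers-of-≤□ : ∀ {a b} → b ≤ □ a → Covers b a
  covers-of-≤□ {a} b≤□a =
    covers-swap (top-upward-closed (proj₁ (□-spec a)) (∨-monotonic refl (¬-antitone b≤□a)))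

  -- ◇ b ≤ a and the cover ¬ b ∨ ◇ b = 1 yield ¬ b ∨ a = 1.
  covers-of-◇≤ : ∀ {a b} → ◇ b ≤ a → Covers b a
  covers-of-◇≤ {b = b} ◇b≤a =
    top-upward-closed (proj₁ (◇-spec b)) (∨-monotonic refl ◇b≤a)

  ◇-lower : ∀ {b a} → b ≤ □ a → ◇ b ≤ a
  ◇-lower {b} {a} b≤□a = proj₂ (◇-spec b) a (covers-of-≤□ b≤□a)

  □-raise : ∀ {b a} → ◇ b ≤ a → b ≤ □ a
  □-raise {b} {a} ◇b≤a = proj₂ (□-spec a) b (covers-swap (covers-of-◇≤ ◇b≤a))

proposition10 : {c ℓ₁ ℓ₂ ι : Level} (A : MeetComplementedLattice c ℓ₁ ℓ₂)
    → let open MeetComplementedLattice A in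
    (□ ◇ : Carrier → Carrier)
    → (∀ a → IsBox a (□ a))
    → (∀ a → IsDiamond a (◇ a))
    → (I : Set ι) (a : I → Carrier)
    → ((m n : Carrier) → IsInfimum lattice a m → IsInfimum lattice (λ i → □ (a i)) n → n ≈ □ m)
    × ((m n : Carrier) → IsSupremum lattice a m → IsSupremum lattice (λ i → ◇ (a i)) n → n ≈ ◇ m)
proposition10 A □ ◇ □-spec ◇-spec _ a =
  right-adjoint-preserves-infima a , left-adjoint-preserves-suprema a
  where
  open MeetComplementedLattice A using (lattice)
  open ModalAdjunction A □ ◇ □-spec ◇-spec using (◇-lower; □-raise)
  open GaloisConnection lattice ◇ □ ◇-lower □-raise
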